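{- There exists an algorithm that produces, for any term $t$, positive integers $m,n_1,\dots,n_m$ and basic terms $t_{i,j}$ for each $i\in\{1,\dots,m\}$ and $j\in\{1,\dots,n_i\}$ such that for every fully distributive involutive residuated lattice $\mathbf{L}$, $\mathbf{L}\models t\approx\bigwedge_{i=1}^m\bigvee_{j=1}^{n_i}t_{i,j}$.
   Context: An involutive residuated lattice is an algebra $\langle L,\wedge,\vee,\cdot,{}',1\rangle$ such that $\langle L,\cdot,1\rangle$ is a monoid, $\langle L,\wedge,\vee\rangle$ is a lattice, ${}'$ is an involution of the lattice ($a\le b\iff b'\le a'$ and $a''=a$), and for all $a,b,c$: $b\le (c'a)'\iff ab\le c\iff a\le (bc')'$. It is fully distributive if its lattice reduct is distributive and $a(b_1\wedge b_2)c=ab_1c\wedge ab_2c$ for all $a,b_1,b_2,c$. Terms are built from a countably infinite set of variables using $\wedge,\vee,\cdot,{}',1$; a term is basic if it is built using only variables, $\cdot$, ${}'$ and $1$. $\mathbf{L}\models s\approx t$ means $h(s)=h(t)$ for every homomorphism $h$ from the term algebra to $\mathbf{L}$. -}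

module Defs where

open import Level using (Level; suc; Setω)
open import Data.Nat using (ℕ)
open import Data.List.NonEmpty using (List⁺; foldr₁; map)
open import Relation.Binary.PropositionalEquality using (_≡_)
open import Algebra.Structures using (IsMonoid)
open import Algebra.Lattice.Structures using (IsLattice; IsDistributiveLattice)
open import Function.Bundles using (_⇔_)

infixl 7 _·_
infixr 6 _∧_
infixr 5 _∨_
data Term : Set where
  var  : ℕ → Term
  _∧_  : Term → Term → Term
  _∨_  : Term → Term → Term
  _·_  : Term → Term → Term
  _′   : Term → Term
  one  : Term

data BasicTerm : Set where
  bvar : ℕ → BasicTerm
  _⊙_  : BasicTerm → BasicTerm → BasicTerm
  bneg : BasicTerm → BasicTerm
  bone : BasicTerm

toTerm : BasicTerm → Term
toTerm (bvar x)  = var x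
toTerm (s ⊙ t)   = toTerm s · toTerm t
toTerm (bneg s)  = toTerm s ′
toTerm bone      = one

record InvolutiveResiduatedLattice (ℓ : Level) : Set (suc ℓ) where
  infixl 7 _*_
  infixr 6 _⊓_
  infixr 5 _⊔ₗ_
  infix 4 _≤_
  field
    Carrier   : Set ℓ
    _⊓_       : Carrier → Carrier → Carrier
    _⊔ₗ_      : Carrier → Carrier → Carrier
    _*_       : Carrier → Carrier → Carrier
    neg       : Carrier → Carrier
    e         : Carrier
    isMonoid  : IsMonoid _≡_ _*_ e
    isLattice : IsLattice _≡_ _⊔ₗ_ _⊓_

  _≤_ : Carrier → Carrier → Set ℓ
  a ≤ b = a ⊓ b ≡ a

  field
    neg-antitone : ∀ a b → (a ≤ b) ⇔ (neg b ≤ neg a)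
    neg-involutive : ∀ a → neg (neg a) ≡ a
    residuation₁ : ∀ a b c → (b ≤ neg (neg c * a)) ⇔ (a * b ≤ c)
    residuation₂ : ∀ a b c → (a * b ≤ c) ⇔ (a ≤ neg (b * neg c))

FullyDistributive : ∀ {ℓ} → InvolutiveResiduatedLattice ℓ → Set ℓ
FullyDistributive L =
  IsDistributiveLattice _≡_ _⊔ₗ_ _⊓_
  × (∀ a b₁ b₂ c → (a * (b₁ ⊓ b₂)) * c ≡ ((a * b₁) * c) ⊓ ((a * b₂) * c))
  where
  open InvolutiveResiduatedLattice L
  open import Data.Product using (_×_)

module _ {ℓ} (L : InvolutiveResiduatedLattice ℓ) where
  open InvolutiveResiduatedLattice L

  ⟦_⟧ : Term → (ℕ → Carrier) → Carrier
  ⟦ var x ⟧ v = v x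
  ⟦ s ∧ t ⟧ v = ⟦ s ⟧ v ⊓ ⟦ t ⟧ v
  ⟦ s ∨ t ⟧ v = ⟦ s ⟧ v ⊔ₗ ⟦ t ⟧ v
  ⟦ s · t ⟧ v = ⟦ s ⟧ v * ⟦ t ⟧ v
  ⟦ s ′ ⟧ v   = neg (⟦ s ⟧ v)
  ⟦ one ⟧ v   = e

  _⊨_≈_ : Term → Term → Set ℓ
  _⊨_≈_ s t = ∀ (v : ℕ → Carrier) → ⟦ s ⟧ v ≡ ⟦ t ⟧ v

⋀ : List⁺ Term → Term
⋀ = foldr₁ _∧_

⋁ : List⁺ Term → Term
⋁ = foldr₁ _∨_

-- A meet of joins of basic terms: the list has length m ≥ 1, the i-th inner list length nᵢ ≥ 1
MeetOfJoins : Set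
MeetOfJoins = List⁺ (List⁺ BasicTerm)

⟪_⟫ : MeetOfJoins → Term
⟪ ts ⟫ = ⋀ (map (λ row → ⋁ (map toTerm row)) ts)

record NormalFormFor (t : Term) : Setω where
  field
    nf      : MeetOfJoins
    correct : ∀ {ℓ} (L : InvolutiveResiduatedLattice ℓ) → FullyDistributive L → L ⊨ t ≈ ⟪ nf ⟫

{-# OPTIONS --safe #-}
module Submission where

-- Multiplication preserves binary joins in each argument because it is residuated there, and
-- binary meets by full distributivity with the unit inserted on the free side; the involution is
-- an antitone Galois connection with itself, so it exchanges meets and joins; and the lattice is
-- distributive. Reading a meet of joins as a list of rows, a meet of normal forms concatenates
-- their rows, a join or a product combines every pair of rows, and the involution of a normal
-- form is the join, over its rows, of the meets of the negated basic terms of the row.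

open import Defs
open import Algebra.Core using (Op₂)
open import Algebra.Definitions using (Associative; _DistributesOverˡ_; _DistributesOverʳ_)
open import Algebra.Structures using (IsMonoid)
open import Algebra.Lattice.Structures using (IsLattice; IsDistributiveLattice)
open import Algebra.Lattice.Properties.Lattice using (∨-∧-orderTheoreticLattice)
open import Data.List using ([]; _∷_)
open import Data.List.NonEmpty using (List⁺; _∷_; [_]; map; foldr₁; _⁺++⁺_)
open import Data.List.NonEmpty.Properties using (map-⁺++⁺; map-∘; map-cong)
open import Data.Nat using (ℕ)
open import Data.Product using (proj₁; proj₂)
open import Function.Base using (_∘_)
open import Function.Bundles using (_⇔_; mk⇔; Equivalence)
import Function.Properties.Equivalence as ⇔
open import Relation.Binary.Lattice.Bundles using (Lattice)
open import Relation.Binary.Lattice.Properties.Lattice using (∧-∨-lattice)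
open import Relation.Binary.PropositionalEquality
  using (_≡_; refl; sym; trans; cong; cong₂; module ≡-Reasoning)
open ≡-Reasoning

open Equivalence using (to; from)

module _ {a} {A : Set a} where

  foldr₁-⁺++⁺ : {_⊕_ : Op₂ A} → Associative _≡_ _⊕_ →
                ∀ xs ys → foldr₁ _⊕_ (xs ⁺++⁺ ys) ≡ foldr₁ _⊕_ xs ⊕ foldr₁ _⊕_ ys
  foldr₁-⁺++⁺ {_⊕_} assoc (x ∷ xs) ys = go x xs
    where
    go : ∀ x xs → foldr₁ _⊕_ ((x ∷ xs) ⁺++⁺ ys) ≡ foldr₁ _⊕_ (x ∷ xs) ⊕ foldr₁ _⊕_ ys
    go x []       = refl
    go x (z ∷ zs) = begin
      x ⊕ foldr₁ _⊕_ ((z ∷ zs) ⁺++⁺ ys)          ≡⟨ cong (x ⊕_) (go z zs) ⟩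
      x ⊕ (foldr₁ _⊕_ (z ∷ zs) ⊕ foldr₁ _⊕_ ys)  ≡⟨ assoc x _ _ ⟨
      (x ⊕ foldr₁ _⊕_ (z ∷ zs)) ⊕ foldr₁ _⊕_ ys  ∎

module _ {a b} {A : Set a} {B : Set b} where

  foldr₁-fusion : (h : A → B) {f : Op₂ A} {g : Op₂ B} → (∀ x y → h (f x y) ≡ g (h x) (h y)) →
                  ∀ xs → h (foldr₁ f xs) ≡ foldr₁ g (map h xs)
  foldr₁-fusion h {f} {g} hom (x ∷ xs) = go x xs
    where
    go : ∀ x xs → h (foldr₁ f (x ∷ xs)) ≡ foldr₁ g (map h (x ∷ xs))
    go x []       = refl
    go x (z ∷ zs) = trans (hom x _) (cong (g (h x)) (go z zs))

module _ {a b c} {A : Set a} {B : Set b} {C : Set c} where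

  cross : (A → B → C) → List⁺ A → List⁺ B → List⁺ C
  cross f xs ys = foldr₁ _⁺++⁺_ (map (λ x → map (f x) ys) xs)

module _ {a} {A : Set a} {_⊕_ : Op₂ A} (⊕-assoc : Associative _≡_ _⊕_) where

  foldr₁-cross : (g : Op₂ A) → _DistributesOverˡ_ _≡_ g _⊕_ → _DistributesOverʳ_ _≡_ g _⊕_ →
                 ∀ xs ys → foldr₁ _⊕_ (cross g xs ys) ≡ g (foldr₁ _⊕_ xs) (foldr₁ _⊕_ ys)
  foldr₁-cross g distribˡ distribʳ xs ys = begin
    foldr₁ _⊕_ (foldr₁ _⁺++⁺_ (map row xs))
      ≡⟨ foldr₁-fusion (foldr₁ _⊕_) {_⁺++⁺_} {_⊕_} (foldr₁-⁺++⁺ ⊕-assoc) (map row xs) ⟩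
    foldr₁ _⊕_ (map (foldr₁ _⊕_) (map row xs))
      ≡⟨ cong (foldr₁ _⊕_) (map-∘ xs) ⟨
    foldr₁ _⊕_ (map (foldr₁ _⊕_ ∘ row) xs)
      ≡⟨ cong (foldr₁ _⊕_) (map-cong row-sum xs) ⟩
    foldr₁ _⊕_ (map (λ x → g x (foldr₁ _⊕_ ys)) xs)
      ≡⟨ foldr₁-fusion (λ x → g x _) (λ x₁ x₂ → distribʳ _ x₁ x₂) xs ⟨
    g (foldr₁ _⊕_ xs) (foldr₁ _⊕_ ys)
      ∎
    where
    row : A → List⁺ A
    row x = map (g x) ys
    row-sum : ∀ x → foldr₁ _⊕_ (row x) ≡ g x (foldr₁ _⊕_ ys)
    row-sum x = sym (foldr₁-fusion (g x) (distribˡ x) ys)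

module _ {a a′ b b′ c d} {A : Set a} {A′ : Set a′} {B : Set b} {B′ : Set b′} {C : Set c} {D : Set d}
         (h : C → D) (hA : A → A′) (hB : B → B′) (f : A → B → C) (g : A′ → B′ → D)
         (h-f : ∀ x y → h (f x y) ≡ g (hA x) (hB y)) where

  map-cross : ∀ xs ys → map h (cross f xs ys) ≡ cross g (map hA xs) (map hB ys)
  map-cross xs ys = begin
    map h (foldr₁ _⁺++⁺_ (map rowᶠ xs))
      ≡⟨ foldr₁-fusion (map h) {_⁺++⁺_} {_⁺++⁺_} (map-⁺++⁺ h) (map rowᶠ xs) ⟩
    foldr₁ _⁺++⁺_ (map (map h) (map rowᶠ xs))
      ≡⟨ cong (foldr₁ _⁺++⁺_) (map-∘ xs) ⟨
    foldr₁ _⁺++⁺_ (map (map h ∘ rowᶠ) xs)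
      ≡⟨ cong (foldr₁ _⁺++⁺_) (map-cong map-row xs) ⟩
    foldr₁ _⁺++⁺_ (map (rowᵍ ∘ hA) xs)
      ≡⟨ cong (foldr₁ _⁺++⁺_) (map-∘ xs) ⟩
    foldr₁ _⁺++⁺_ (map rowᵍ (map hA xs))
      ∎
    where
    rowᶠ : A → List⁺ C
    rowᶠ x = map (f x) ys
    rowᵍ : A′ → List⁺ D
    rowᵍ x = map (g x) (map hB ys)
    map-row : ∀ x → map h (rowᶠ x) ≡ rowᵍ (hA x)
    map-row x = begin
      map h (map (f x) ys)         ≡⟨ map-∘ ys ⟨
      map (h ∘ f x) ys             ≡⟨ map-cong (h-f x) ys ⟩
      map (g (hA x) ∘ hB) ys       ≡⟨ map-∘ ys ⟩
      map (g (hA x)) (map hB ys)   ∎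

module _ {a b c d} {A : Set a} {B : Set b} {C : Set c} {D : Set d}
         {_⊕_ : Op₂ D} (⊕-assoc : Associative _≡_ _⊕_)
         (g : Op₂ D) (distribˡ : _DistributesOverˡ_ _≡_ g _⊕_) (distribʳ : _DistributesOverʳ_ _≡_ g _⊕_)
         (h : C → D) (hA : A → D) (hB : B → D) (f : A → B → C)
         (h-f : ∀ x y → h (f x y) ≡ g (hA x) (hB y)) where

  foldr₁-map-cross : ∀ xs ys → foldr₁ _⊕_ (map h (cross f xs ys))
                               ≡ g (foldr₁ _⊕_ (map hA xs)) (foldr₁ _⊕_ (map hB ys))
  foldr₁-map-cross xs ys = trans (cong (foldr₁ _⊕_) (map-cross h hA hB f g h-f xs ys))
                                 (foldr₁-cross ⊕-assoc g distribˡ distribʳ (map hA xs) (map hB ys))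

module _ {c ℓ₁ ℓ₂} (R : Lattice c ℓ₁ ℓ₂) where
  open Lattice R renaming (_∨_ to _⊔_; _∧_ to _⊓_; refl to ≤-refl; trans to ≤-trans)

  lowerAdjoint-preserves-⊔ : (f g : Carrier → Carrier) → (∀ x z → f x ≤ z ⇔ x ≤ g z) →
                             ∀ x y → f (x ⊔ y) ≈ f x ⊔ f y
  lowerAdjoint-preserves-⊔ f g adjoint x y = antisym
    (from (adjoint _ _) (∨-least (to (adjoint _ _) (x≤x∨y _ _)) (to (adjoint _ _) (y≤x∨y _ _))))
    (∨-least (monotone (x≤x∨y x y)) (monotone (y≤x∨y x y)))
    where
    monotone : ∀ {u w} → u ≤ w → f u ≤ f w
    monotone u≤w = from (adjoint _ _) (≤-trans u≤w (to (adjoint _ _) ≤-refl))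

  module _ (¬_ : Carrier → Carrier) (¬-antitone : ∀ x y → x ≤ y ⇔ ¬ y ≤ ¬ x)
           (¬-involutive : ∀ x → ¬ (¬ x) ≈ x) where

    ¬-swap : ∀ {x w} → x ≤ ¬ w → w ≤ ¬ x
    ¬-swap {x} {w} x≤¬w = ≤-respˡ-≈ (¬-involutive w) (to (¬-antitone x (¬ w)) x≤¬w)

    antitoneInvolution-⊔ : ∀ x y → ¬ (x ⊔ y) ≈ ¬ x ⊓ ¬ y
    antitoneInvolution-⊔ x y = antisym
      (∧-greatest (to (¬-antitone _ _) (x≤x∨y x y)) (to (¬-antitone _ _) (y≤x∨y x y)))
      (¬-swap (∨-least (¬-swap (x∧y≤x _ _)) (¬-swap (x∧y≤y _ _))))

module _ {c ℓ₁ ℓ₂} (R : Lattice c ℓ₁ ℓ₂) where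
  open Lattice R renaming (_∨_ to _⊔_; _∧_ to _⊓_)

  antitoneInvolution-⊓ : (¬_ : Carrier → Carrier) → (∀ x y → x ≤ y ⇔ ¬ y ≤ ¬ x) →
                         (∀ x → ¬ (¬ x) ≈ x) → ∀ x y → ¬ (x ⊓ y) ≈ ¬ x ⊔ ¬ y
  antitoneInvolution-⊓ ¬_ ¬-antitone =
    antitoneInvolution-⊔ (∧-∨-lattice R) ¬_ (λ x y → ¬-antitone y x)

module FullyDistributiveProperties {ℓ} (L : InvolutiveResiduatedLattice ℓ) (fd : FullyDistributive L)
  where
  open InvolutiveResiduatedLattice L
  open IsMonoid isMonoid using (identityˡ; identityʳ)

  orderLattice : Lattice ℓ ℓ ℓ
  orderLattice = ∨-∧-orderTheoreticLattice
    (record { Carrier = Carrier; _≈_ = _≡_; _∨_ = _⊔ₗ_; _∧_ = _⊓_; isLattice = isLattice })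

  open Lattice orderLattice using () renaming (_≤_ to _≤ₒ_)

  ≤ₒ⇔≤ : ∀ {x y} → x ≤ₒ y ⇔ x ≤ y
  ≤ₒ⇔≤ = mk⇔ sym sym

  ≤-transport : ∀ {x y u w} → (x ≤ y ⇔ u ≤ w) → (x ≤ₒ y ⇔ u ≤ₒ w)
  ≤-transport x≤y⇔u≤w = ⇔.trans ≤ₒ⇔≤ (⇔.trans x≤y⇔u≤w (⇔.sym ≤ₒ⇔≤))

  *-distribˡ-⊔ : _DistributesOverˡ_ _≡_ _*_ _⊔ₗ_
  *-distribˡ-⊔ x = lowerAdjoint-preserves-⊔ orderLattice (x *_) (λ z → neg (neg z * x))
    (λ y z → ≤-transport (⇔.sym (residuation₁ x y z)))

  *-distribʳ-⊔ : _DistributesOverʳ_ _≡_ _*_ _⊔ₗ_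
  *-distribʳ-⊔ y = lowerAdjoint-preserves-⊔ orderLattice (_* y) (λ z → neg (y * neg z))
    (λ x z → ≤-transport (residuation₂ x y z))

  *-distribˡ-⊓ : _DistributesOverˡ_ _≡_ _*_ _⊓_
  *-distribˡ-⊓ x y z = begin
    x * (y ⊓ z)                ≡⟨ identityʳ _ ⟨
    x * (y ⊓ z) * e            ≡⟨ proj₂ fd x y z e ⟩
    x * y * e ⊓ x * z * e      ≡⟨ cong₂ _⊓_ (identityʳ _) (identityʳ _) ⟩
    x * y ⊓ x * z              ∎

  *-distribʳ-⊓ : _DistributesOverʳ_ _≡_ _*_ _⊓_
  *-distribʳ-⊓ x y z = begin
    (y ⊓ z) * x                ≡⟨ cong (_* x) (identityˡ _) ⟨
    e * (y ⊓ z) * x            ≡⟨ proj₂ fd e y z x ⟩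
    e * y * x ⊓ e * z * x      ≡⟨ cong₂ (λ u w → u * x ⊓ w * x) (identityˡ y) (identityˡ z) ⟩
    y * x ⊓ z * x              ∎

  neg-⊔ : ∀ x y → neg (x ⊔ₗ y) ≡ neg x ⊓ neg y
  neg-⊔ = antitoneInvolution-⊔ orderLattice neg (λ x y → ≤-transport (neg-antitone x y))
                               neg-involutive

  neg-⊓ : ∀ x y → neg (x ⊓ y) ≡ neg x ⊔ₗ neg y
  neg-⊓ = antitoneInvolution-⊓ orderLattice neg (λ x y → ≤-transport (neg-antitone x y))
                               neg-involutive

Row : Set
Row = List⁺ BasicTerm

infixr 6 _∧ₙ_
infixr 5 _∨ₙ_
infixl 7 _·ᵣ_ _·ₙ_
infix 8 _′ᵣ _′ₙ

_∧ₙ_ : MeetOfJoins → MeetOfJoins → MeetOfJoins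
_∧ₙ_ = _⁺++⁺_

_∨ₙ_ : MeetOfJoins → MeetOfJoins → MeetOfJoins
_∨ₙ_ = cross _⁺++⁺_

_·ᵣ_ : Row → Row → Row
_·ᵣ_ = cross _⊙_

_·ₙ_ : MeetOfJoins → MeetOfJoins → MeetOfJoins
_·ₙ_ = cross _·ᵣ_

_′ᵣ : Row → MeetOfJoins
r ′ᵣ = map (λ b → [ bneg b ]) r

_′ₙ : MeetOfJoins → MeetOfJoins
n ′ₙ = foldr₁ _∨ₙ_ (map _′ᵣ n)

normalise : Term → MeetOfJoins
normalise (var x) = [ [ bvar x ] ]
normalise (s ∧ t) = normalise s ∧ₙ normalise t
normalise (s ∨ t) = normalise s ∨ₙ normalise t
normalise (s · t) = normalise s ·ₙ normalise t
normalise (s ′)   = normalise s ′ₙ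
normalise one     = [ [ bone ] ]

module Soundness {ℓ} (L : InvolutiveResiduatedLattice ℓ) (fd : FullyDistributive L)
                 (v : ℕ → InvolutiveResiduatedLattice.Carrier L) where
  open InvolutiveResiduatedLattice L
  open FullyDistributiveProperties L fd
  open IsLattice isLattice using (∨-assoc; ∧-assoc)
  open IsDistributiveLattice (proj₁ fd) using (∨-distribˡ-∧; ∨-distribʳ-∧)

  eval : Term → Carrier
  eval t = ⟦_⟧ L t v

  ⟦_⟧ᵣ : Row → Carrier
  ⟦ r ⟧ᵣ = foldr₁ _⊔ₗ_ (map (eval ∘ toTerm) r)

  ⟦_⟧ₙ : MeetOfJoins → Carrier
  ⟦ n ⟧ₙ = foldr₁ _⊓_ (map ⟦_⟧ᵣ n)

  eval-⟪⟫ : ∀ n → eval ⟪ n ⟫ ≡ ⟦ n ⟧ₙ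
  eval-⟪⟫ n = begin
    eval (⋀ (map joinTerm n))               ≡⟨ foldr₁-fusion eval {_∧_} (λ _ _ → refl) (map joinTerm n) ⟩
    foldr₁ _⊓_ (map eval (map joinTerm n))  ≡⟨ cong (foldr₁ _⊓_) (map-∘ n) ⟨
    foldr₁ _⊓_ (map (eval ∘ joinTerm) n)    ≡⟨ cong (foldr₁ _⊓_) (map-cong eval-joinTerm n) ⟩
    ⟦ n ⟧ₙ                                  ∎
    where
    joinTerm : Row → Term
    joinTerm r = ⋁ (map toTerm r)
    eval-joinTerm : ∀ r → eval (joinTerm r) ≡ ⟦ r ⟧ᵣ
    eval-joinTerm r = trans (foldr₁-fusion eval {_∨_} {_⊔ₗ_} (λ _ _ → refl) (map toTerm r))
                            (sym (cong (foldr₁ _⊔ₗ_) (map-∘ r)))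

  ⟦⁺++⁺⟧ᵣ : ∀ r q → ⟦ r ⁺++⁺ q ⟧ᵣ ≡ ⟦ r ⟧ᵣ ⊔ₗ ⟦ q ⟧ᵣ
  ⟦⁺++⁺⟧ᵣ r q = trans (cong (foldr₁ _⊔ₗ_) (map-⁺++⁺ (eval ∘ toTerm) r q))
                      (foldr₁-⁺++⁺ ∨-assoc (map (eval ∘ toTerm) r) (map (eval ∘ toTerm) q))

  ⟦∧ₙ⟧ : ∀ n m → ⟦ n ∧ₙ m ⟧ₙ ≡ ⟦ n ⟧ₙ ⊓ ⟦ m ⟧ₙ
  ⟦∧ₙ⟧ n m = trans (cong (foldr₁ _⊓_) (map-⁺++⁺ ⟦_⟧ᵣ n m))
                   (foldr₁-⁺++⁺ ∧-assoc (map ⟦_⟧ᵣ n) (map ⟦_⟧ᵣ m))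

  ⟦∨ₙ⟧ : ∀ n m → ⟦ n ∨ₙ m ⟧ₙ ≡ ⟦ n ⟧ₙ ⊔ₗ ⟦ m ⟧ₙ
  ⟦∨ₙ⟧ = foldr₁-map-cross ∧-assoc _⊔ₗ_ ∨-distribˡ-∧ ∨-distribʳ-∧ ⟦_⟧ᵣ ⟦_⟧ᵣ ⟦_⟧ᵣ _⁺++⁺_ ⟦⁺++⁺⟧ᵣ

  ⟦·ᵣ⟧ : ∀ r q → ⟦ r ·ᵣ q ⟧ᵣ ≡ ⟦ r ⟧ᵣ * ⟦ q ⟧ᵣ
  ⟦·ᵣ⟧ = foldr₁-map-cross ∨-assoc _*_ *-distribˡ-⊔ *-distribʳ-⊔ _ _ _ _⊙_ (λ _ _ → refl)

  ⟦·ₙ⟧ : ∀ n m → ⟦ n ·ₙ m ⟧ₙ ≡ ⟦ n ⟧ₙ * ⟦ m ⟧ₙ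
  ⟦·ₙ⟧ = foldr₁-map-cross ∧-assoc _*_ *-distribˡ-⊓ *-distribʳ-⊓ ⟦_⟧ᵣ ⟦_⟧ᵣ ⟦_⟧ᵣ _·ᵣ_ ⟦·ᵣ⟧

  ⟦′ᵣ⟧ : ∀ r → ⟦ r ′ᵣ ⟧ₙ ≡ neg ⟦ r ⟧ᵣ
  ⟦′ᵣ⟧ r = begin
    foldr₁ _⊓_ (map ⟦_⟧ᵣ (map (λ b → [ bneg b ]) r))   ≡⟨ cong (foldr₁ _⊓_) (map-∘ r) ⟨
    foldr₁ _⊓_ (map (neg ∘ eval ∘ toTerm) r)          ≡⟨ cong (foldr₁ _⊓_) (map-∘ r) ⟩
    foldr₁ _⊓_ (map neg (map (eval ∘ toTerm) r))      ≡⟨ foldr₁-fusion neg neg-⊔ (map (eval ∘ toTerm) r) ⟨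
    neg ⟦ r ⟧ᵣ                                        ∎

  ⟦′ₙ⟧ : ∀ n → ⟦ n ′ₙ ⟧ₙ ≡ neg ⟦ n ⟧ₙ
  ⟦′ₙ⟧ n = begin
    ⟦ foldr₁ _∨ₙ_ (map _′ᵣ n) ⟧ₙ                ≡⟨ foldr₁-fusion ⟦_⟧ₙ ⟦∨ₙ⟧ (map _′ᵣ n) ⟩
    foldr₁ _⊔ₗ_ (map ⟦_⟧ₙ (map _′ᵣ n))          ≡⟨ cong (foldr₁ _⊔ₗ_) (map-∘ n) ⟨
    foldr₁ _⊔ₗ_ (map (⟦_⟧ₙ ∘ _′ᵣ) n)            ≡⟨ cong (foldr₁ _⊔ₗ_) (map-cong ⟦′ᵣ⟧ n) ⟩
    foldr₁ _⊔ₗ_ (map (neg ∘ ⟦_⟧ᵣ) n)            ≡⟨ cong (foldr₁ _⊔ₗ_) (map-∘ n) ⟩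
    foldr₁ _⊔ₗ_ (map neg (map ⟦_⟧ᵣ n))          ≡⟨ foldr₁-fusion neg neg-⊓ (map ⟦_⟧ᵣ n) ⟨
    neg ⟦ n ⟧ₙ                                  ∎

  normalise-sound : ∀ t → eval t ≡ ⟦ normalise t ⟧ₙ
  normalise-sound (var x) = refl
  normalise-sound (s ∧ t) =
    trans (cong₂ _⊓_ (normalise-sound s) (normalise-sound t)) (sym (⟦∧ₙ⟧ (normalise s) (normalise t)))
  normalise-sound (s ∨ t) =
    trans (cong₂ _⊔ₗ_ (normalise-sound s) (normalise-sound t)) (sym (⟦∨ₙ⟧ (normalise s) (normalise t)))
  normalise-sound (s · t) =
    trans (cong₂ _*_ (normalise-sound s) (normalise-sound t)) (sym (⟦·ₙ⟧ (normalise s) (normalise t)))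
  normalise-sound (s ′)   = trans (cong neg (normalise-sound s)) (sym (⟦′ₙ⟧ (normalise s)))
  normalise-sound one     = refl

  normalise-correct : ∀ t → eval t ≡ eval ⟪ normalise t ⟫
  normalise-correct t = trans (normalise-sound t) (sym (eval-⟪⟫ (normalise t)))

lemma2p1 : (t : Term) → NormalFormFor t
lemma2p1 t = record
  { nf      = normalise t
  ; correct = λ L fd v → Soundness.normalise-correct L fd v t
  }
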